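{- Let $X$ be a t-diagram and let $(G,\varphi)$ be a characteristic tree of $X$. For a white point $B$ and a black point $A_i$ of $X$, the following are equivalent: (1) $B$ corresponds to $A_i$; (2) the leaf $\varphi(A_i)$ of $G$ is joined by an edge to the vertex $\varphi(B)$.
   Context: A t-diagram is a set $X$ of $2d+4$ black and white points in the plane ($d\ge 0$) such that: the points are in general position; exactly $d+3$ are black and in convex position; no white point lies outside the convex hull of the black points; every triangle with black vertices contains exactly one white point. Black points are labeled $A_1,\dots,A_{d+3}$ clockwise along the boundary of their convex hull, indices modulo $d+3$. The white point lying inside the triangle $A_{i-1}A_iA_{i+1}$ (unique) is said to correspond to $A_i$. A 3-tree is a finite tree all of whose vertices have degree 1 or 3, with a cyclic order on the three edges at each degree-3 vertex; it induces a cyclic order on the leaves (walk around the tree, at each degree-3 vertex leaving along the edge following the arrival edge). A characteristic tree of $X$ is a 3-tree $G$ with a bijection $\varphi$ from $X$ to the vertices of $G$ such that: (i) white points go to degree-3 vertices, black points to leaves; (ii) the unoriented cyclic order of leaves agrees via $\varphi$ with the unoriented cyclic order of black points along the boundary of their convex hull; (iii) a white point $B$ lies inside the triangle with black vertices $A_i,A_j,A_k$ iff there are three paths from $\varphi(B)$ to $\varphi(A_i),\varphi(A_j),\varphi(A_k)$ pairwise sharing only $\varphi(B)$. -}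

module Defs where

open import Level using (Level; _⊔_) renaming (suc to lsuc; zero to lzero)
open import Data.Nat as ℕ using (ℕ; zero; suc; _≤_)
open import Data.Nat.Properties using (_<?_)
open import Data.Fin using (Fin; zero; suc; toℕ; fromℕ; fromℕ<; inject₁)
open import Data.Sum using (_⊎_; inj₁; inj₂)
open import Data.Product using (Σ; ∃; ∃!; _×_; _,_)
open import Data.List using (List; length; head; last)
open import Data.List.Membership.Propositional using (_∈_)
open import Data.List.Relation.Unary.Unique.Propositional using (Unique)
open import Data.Maybe using (just)
open import Relation.Nullary using (¬_; yes; no)
open import Relation.Binary using (Rel; IsStrictTotalOrder)
open import Relation.Binary.PropositionalEquality using (_≡_; _≢_)
open import Algebra.Bundles using (CommutativeRing)
open import Function using (_∘_)
open import Function.Definitions using (Bijective)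
open import Function.Bundles using (_⇔_)

csuc : ∀ {n} → Fin (suc n) → Fin (suc n)
csuc {n} i with suc (toℕ i) <? suc n
... | yes p = fromℕ< p
... | no _  = zero

cpred : ∀ {n} → Fin (suc n) → Fin (suc n)
cpred {n} zero    = fromℕ n
cpred {n} (suc i) = inject₁ i

-- Ordered commutative rings (the real numbers are an instance).
-- The plane is Carrier × Carrier.

record OrderedCommRing (c ℓ₁ ℓ₂ : Level) : Set (lsuc (c ⊔ ℓ₁ ⊔ ℓ₂)) where
  field
    commutativeRing : CommutativeRing c ℓ₁
  open CommutativeRing commutativeRing public
  field
    _<_                : Rel Carrier ℓ₂
    isStrictTotalOrder : IsStrictTotalOrder _≈_ _<_
    0<1                : 0# < 1#
    +-mono-<           : ∀ {x y} z → x < y → (x + z) < (y + z)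
    *-pos              : ∀ {x y} → 0# < x → 0# < y → 0# < (x * y)

module Graphs {n : ℕ} (Adj : Fin n → Fin n → Set) where

  data Chain : List (Fin n) → Set where
    one  : ∀ v → Chain (v List.∷ List.[])
    cons : ∀ u v vs → Adj u v → Chain (v List.∷ vs) → Chain (u List.∷ v List.∷ vs)

  Path : Fin n → Fin n → List (Fin n) → Set
  Path x y xs = Chain xs × head xs ≡ just x × last xs ≡ just y × Unique xs

  Connected : Set
  Connected = ∀ u v → ∃ λ xs → Path u v xs

  -- no cycle: an edge u–v together with a path v … u of ≥ 3 vertices
  Acyclic : Set
  Acyclic = ∀ u v xs → Adj u v → Path v u xs → length xs ≤ 2

  Simple : Set
  Simple = (∀ u v → Adj u v → Adj v u) × (∀ v → ¬ Adj v v)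

  IsTree : Set
  IsTree = Simple × Connected × Acyclic

  Leaf : Fin n → Set
  Leaf v = ∃ λ u → Adj v u × (∀ w → Adj v w → w ≡ u)

  Deg3 : Fin n → Set
  Deg3 v = Σ (Fin n) λ a → Σ (Fin n) λ b → Σ (Fin n) λ c →
    a ≢ b × b ≢ c × a ≢ c × Adj v a × Adj v b × Adj v c ×
    (∀ w → Adj v w → w ≡ a ⊎ w ≡ b ⊎ w ≡ c)

  -- degree exactly 3, and  rot v  cyclically permutes the three neighbours
  -- (this is the cyclic order of the edges at v)
  Deg3Rot : (Fin n → Fin n → Fin n) → Fin n → Set
  Deg3Rot rot v = Σ (Fin n) λ a → Σ (Fin n) λ b → Σ (Fin n) λ c →
    a ≢ b × b ≢ c × a ≢ c × Adj v a × Adj v b × Adj v c ×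
    (∀ w → Adj v w → w ≡ a ⊎ w ≡ b ⊎ w ≡ c) ×
    rot v a ≡ b × rot v b ≡ c × rot v c ≡ a

  Is3Tree : (Fin n → Fin n → Fin n) → Set
  Is3Tree rot = IsTree × (∀ v → Leaf v ⊎ Deg3Rot rot v)

  -- Walk around the tree: having traversed the dart u → v, the next dart is
  -- v → rot v u.  FirstLeaf rot ℓ u v : walking on from the dart u → v,
  -- the first leaf reached (possibly v itself) is ℓ.
  data FirstLeaf (rot : Fin n → Fin n → Fin n) (ℓ : Fin n) : Fin n → Fin n → Set where
    stop : ∀ {u} → Leaf ℓ → FirstLeaf rot ℓ u ℓ
    go   : ∀ {u v} → ¬ Leaf v → FirstLeaf rot ℓ v (rot v u) → FirstLeaf rot ℓ u v

  -- ℓ′ is the leaf following the leaf ℓ in the induced cyclic order of leaves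
  NextLeaf : (Fin n → Fin n → Fin n) → Fin n → Fin n → Set
  NextLeaf rot ℓ ℓ′ = ∃ λ u → Adj ℓ u × FirstLeaf rot ℓ′ ℓ u

  ThreePaths : Fin n → Fin n → Fin n → Fin n → Set
  ThreePaths b x y z = Σ (List (Fin n)) λ p → Σ (List (Fin n)) λ q → Σ (List (Fin n)) λ r →
    Path b x p × Path b y q × Path b z r ×
    (∀ v → v ∈ p → v ∈ q → v ≡ b) ×
    (∀ v → v ∈ p → v ∈ r → v ≡ b) ×
    (∀ v → v ∈ q → v ∈ r → v ≡ b)

module Geometry {c ℓ₁ ℓ₂} (R : OrderedCommRing c ℓ₁ ℓ₂) where
  open OrderedCommRing R using (Carrier; _≈_; _+_; _*_; _-_; 0#; _<_)

  Point : Set c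
  Point = Carrier × Carrier

  px py : Point → Carrier
  px (x , _) = x
  py (_ , y) = y

  -- twice the signed area; positive = counterclockwise, negative = clockwise
  orient : Point → Point → Point → Carrier
  orient p q r = ((px q - px p) * (py r - py p)) - ((py q - py p) * (px r - px p))

  InTriangle : Point → Point → Point → Point → Set ℓ₂
  InTriangle a b c p =
    (0# < orient a b p × 0# < orient b c p × 0# < orient c a p) ⊎
    (orient a b p < 0# × orient b c p < 0# × orient c a p < 0#)

  ∑ : ∀ {m} → (Fin m → Carrier) → Carrier
  ∑ {zero}  f = 0#
  ∑ {suc m} f = f zero + ∑ (f ∘ suc)

  InHull : ∀ {m} → (Fin m → Point) → Point → Set (c ⊔ ℓ₁ ⊔ ℓ₂)
  InHull {m} P p = Σ (Fin m → Carrier) λ λ′ →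
    (∀ i → ¬ (λ′ i < 0#)) × 0# < ∑ λ′ ×
    ∑ (λ i → λ′ i * px (P i)) ≈ ∑ λ′ * px p ×
    ∑ (λ i → λ′ i * py (P i)) ≈ ∑ λ′ * py p

  -- indices of the 2d+4 points: inj₁ i = black A_i (d+3 of them), inj₂ w = white (d+1)
  Idx : ℕ → Set
  Idx d = Fin (3 ℕ.+ d) ⊎ Fin (suc d)

  joinPts : ∀ {d} → (Fin (3 ℕ.+ d) → Point) → (Fin (suc d) → Point) → Idx d → Point
  joinPts A W (inj₁ i) = A i
  joinPts A W (inj₂ w) = W w

  record TDiagram (d : ℕ) : Set (c ⊔ ℓ₁ ⊔ ℓ₂) where
    field
      black : Fin (3 ℕ.+ d) → Point
      white : Fin (suc d) → Point
      generalPosition : ∀ x y z → x ≢ y → y ≢ z → x ≢ z →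
        ¬ (orient (joinPts black white x) (joinPts black white y) (joinPts black white z) ≈ 0#)
      -- the black points are in convex position, labeled clockwise along
      -- the boundary of their convex hull: every edge A_i A_{i+1} has all other
      -- black points strictly on its right
      clockwiseConvex : ∀ i j → j ≢ i → j ≢ csuc i →
        orient (black i) (black (csuc i)) (black j) < 0#
      whiteInHull : ∀ w → InHull black (white w)
      uniqueWhite : ∀ i j k → i ≢ j → j ≢ k → i ≢ k →
        ∃! _≡_ (λ w → InTriangle (black i) (black j) (black k) (white w))

  Corresponds : ∀ {d} → TDiagram d → Fin (suc d) → Fin (3 ℕ.+ d) → Set ℓ₂
  Corresponds X w i = InTriangle (black (cpred i)) (black i) (black (csuc i)) (white w)
    where open TDiagram X

  record CharTree {d : ℕ} (X : TDiagram d) : Set (c ⊔ ℓ₁ ⊔ lsuc ℓ₂) where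
    open TDiagram X
    field
      size : ℕ
      Adj  : Fin size → Fin size → Set
      rot  : Fin size → Fin size → Fin size
      φ    : Idx d → Fin size
    open Graphs Adj public
    field
      is3Tree  : Is3Tree rot
      φ-bij    : Bijective _≡_ _≡_ φ
      whiteDeg3 : ∀ w → Deg3 (φ (inj₂ w))
      blackLeaf : ∀ i → Leaf (φ (inj₁ i))
      -- (ii) unoriented cyclic order of leaves = cyclic order of black points
      leafOrder : (∀ i → NextLeaf rot (φ (inj₁ i)) (φ (inj₁ (csuc i)))) ⊎
                  (∀ i → NextLeaf rot (φ (inj₁ i)) (φ (inj₁ (cpred i))))
      triangles : ∀ w i j k → i ≢ j → j ≢ k → i ≢ k →
        InTriangle (black i) (black j) (black k) (white w) ⇔
        ThreePaths (φ (inj₂ w)) (φ (inj₁ i)) (φ (inj₁ j)) (φ (inj₁ k))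

-- By condition (iii), "B corresponds to A_i" means that there are three paths
-- from φ(B) to the leaves φ(A_{i-1}), φ(A_i), φ(A_{i+1}) sharing only φ(B); by
-- (ii) these three leaves are consecutive in the cyclic order of leaves (in one
-- of the two orientations).  So the theorem is an instance of a purely
-- tree-theoretic fact: if P, L, N are consecutive leaves of a 3-tree, c is the
-- neighbour of L and b is any inner vertex, then three such paths from b to
-- P, L, N exist iff b = c.
--
-- The walk around the tree from the leaf P never turns back, so in a tree it
-- is the path from P to L; it enters L from c, arriving at c from the
-- neighbour s with rot c s = L.  Likewise the walk from L to N is the path
-- L, c, rot c L, ….  Hence the paths from c to P, L, N leave c through the
-- three distinct neighbours s, L, rot c L and share only c.  Conversely, if
-- b ≠ c, the path from b to L passes c coming from a neighbour s′; acyclicity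
-- forces both s = s′ and rot c L = s′, contradicting that rot c permutes
-- three distinct neighbours.

module Submission where

open import Defs
open import Level using (Level)
open import Data.Nat using (ℕ; suc; _+_)
open import Data.Fin using (Fin)
open import Data.Sum using (inj₁; inj₂)
open import Function.Bundles using (_⇔_)

import Data.Nat as ℕ
import Data.Nat.Properties as ℕₚ
open import Data.Nat.Properties using (_<?_)
open import Data.Fin using (zero; suc; toℕ; fromℕ; inject₁)
open import Data.Fin.Properties
  using (_≟_; suc-injective; toℕ-injective; toℕ-fromℕ; toℕ-fromℕ<; toℕ-inject₁; inject₁ℕ<)
open import Data.Empty using (⊥; ⊥-elim)
open import Data.Product using (∃; ∃₂; _×_; _,_; proj₁; proj₂)
open import Data.Sum using (_⊎_)
open import Data.List using (List; []; _∷_; _++_; length)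
open import Data.List.Properties using (++-assoc)
open import Data.List.Membership.Propositional using (_∈_; _∉_)
open import Data.List.Membership.Propositional.Properties using (∈-++⁺ˡ; ∈-++⁺ʳ; ∈-++⁻; ∈-∃++)
open import Data.List.Relation.Binary.Subset.Propositional using (_⊆_)
open import Data.List.Relation.Unary.Any using (here; there)
open import Data.List.Relation.Unary.All as All using ([]; _∷_)
open import Data.List.Relation.Unary.All.Properties using (¬Any⇒All¬)
open import Data.List.Relation.Unary.AllPairs using ([]; _∷_)
open import Data.List.Relation.Unary.Unique.Propositional using (Unique)
import Data.List.Relation.Unary.Unique.Propositional.Properties as Unique
open import Data.Maybe using (just)
open import Data.Maybe.Properties using (just-injective)
open import Relation.Nullary using (¬_; yes; no)
open import Relation.Binary.PropositionalEquality using (_≡_; _≢_; refl; sym; trans; cong; subst)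
open import Function.Bundles using (mk⇔)
import Function.Properties.Equivalence as ⇔

csuc-fromℕ : ∀ n → csuc (fromℕ n) ≡ zero
csuc-fromℕ n with suc (toℕ (fromℕ n)) <? suc n
... | yes p = ⊥-elim (ℕₚ.n≮n (suc n) (subst (λ k → suc k ℕ.< suc n) (toℕ-fromℕ n) p))
... | no _  = refl

csuc-inject₁ : ∀ {n} (j : Fin n) → csuc (inject₁ j) ≡ suc j
csuc-inject₁ {n} j with suc (toℕ (inject₁ j)) <? suc n
... | yes p = toℕ-injective (trans (toℕ-fromℕ< p) (cong suc (toℕ-inject₁ j)))
... | no ¬p = ⊥-elim (¬p (ℕ.s≤s (inject₁ℕ< j)))

data LastOrInject : ∀ {n} → Fin (suc n) → Set where
  isLast   : ∀ {n} → LastOrInject (fromℕ n)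
  isInject : ∀ {n} (j : Fin n) → LastOrInject (inject₁ j)

lastOrInject : ∀ {n} (i : Fin (suc n)) → LastOrInject i
lastOrInject {ℕ.zero} zero    = isLast
lastOrInject {suc n}  zero    = isInject zero
lastOrInject {suc n}  (suc i) with lastOrInject i
... | isLast     = isLast
... | isInject j = isInject (suc j)

csuc-cpred : ∀ {n} (i : Fin (suc n)) → csuc (cpred i) ≡ i
csuc-cpred {n} zero = csuc-fromℕ n
csuc-cpred (suc j)  = csuc-inject₁ j

cpred-csuc : ∀ {n} (i : Fin (suc n)) → cpred (csuc i) ≡ i
cpred-csuc i with lastOrInject i
... | isLast     = cong cpred (csuc-fromℕ _)
... | isInject j = cong cpred (csuc-inject₁ j)

inject₁≢suc : ∀ {n} (j : Fin n) → inject₁ j ≢ suc j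
inject₁≢suc zero    ()
inject₁≢suc (suc j) e = inject₁≢suc j (suc-injective e)

inject₁²≢suc² : ∀ {n} (j : Fin n) → inject₁ (inject₁ j) ≢ suc (suc j)
inject₁²≢suc² zero    ()
inject₁²≢suc² (suc j) e = inject₁²≢suc² j (suc-injective e)

-- With at least two (resp. three) indices, i-1, i (resp. i-1, i, i+1) are distinct;
-- these are the side conditions of condition (iii) for the triangle A_{i-1} A_i A_{i+1}.
cpred≢ : ∀ {n} (i : Fin (suc (suc n))) → cpred i ≢ i
cpred≢ zero    ()
cpred≢ (suc j) = inject₁≢suc j

≢csuc : ∀ {n} (i : Fin (suc (suc n))) → i ≢ csuc i
≢csuc i e = cpred≢ i (trans (cong cpred e) (cpred-csuc i))

cpred²≢ : ∀ {n} (i : Fin (3 + n)) → cpred (cpred i) ≢ i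
cpred²≢ zero          ()
cpred²≢ (suc zero)    ()
cpred²≢ (suc (suc k)) = inject₁²≢suc² k

cpred≢csuc : ∀ {n} (i : Fin (3 + n)) → cpred i ≢ csuc i
cpred≢csuc i e = cpred²≢ i (trans (cong cpred e) (cpred-csuc i))

unique-++-disjoint : ∀ {A : Set} (xs : List A) {ys m} → Unique (xs ++ ys) → m ∈ xs → m ∉ ys
unique-++-disjoint (x ∷ xs) (x∉ ∷ _) (here refl) q = All.lookup x∉ (∈-++⁺ʳ xs q) refl
unique-++-disjoint (x ∷ xs) (_ ∷ u)  (there p)   q = unique-++-disjoint xs u p q

module Walks {n : ℕ} (Adj : Fin n → Fin n → Set) (Adj-sym : ∀ {u v} → Adj u v → Adj v u) where
  open Graphs Adj using (Chain; one; cons; Path)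

  V : Set
  V = Fin n

  data Walk : V → List V → V → Set where
    done : ∀ {x} → Walk x [] x
    step : ∀ {x z ys y} → Adj x z → Walk z ys y → Walk x (z ∷ ys) y

  walk-[] : ∀ {x y} → Walk x [] y → x ≡ y
  walk-[] done = refl

  _++ʷ_ : ∀ {x ys y zs z} → Walk x ys y → Walk y zs z → Walk x (ys ++ zs) z
  done     ++ʷ w′ = w′
  step a w ++ʷ w′ = step a (w ++ʷ w′)

  end∈ : ∀ {x ys y} → Walk x ys y → y ∈ x ∷ ys
  end∈ done       = here refl
  end∈ (step a w) = there (end∈ w)

  final : V → List V → V
  final x []       = x
  final x (y ∷ ys) = final y ys

  final∈ : ∀ x ys → final x ys ∈ x ∷ ys
  final∈ x []       = here refl
  final∈ x (y ∷ ys) = there (final∈ y ys)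

  reverseʷ : ∀ {x ys y} → Walk x ys y → ∃ λ zs → Walk y zs x × (y ∷ zs) ⊆ (x ∷ ys)
  reverseʷ done = [] , done , λ p → p
  reverseʷ {x} {y = y} (step {z = z} {ys = ys} a w) with reverseʷ w
  ... | zs , w′ , sub = zs ++ x ∷ [] , w′ ++ʷ step (Adj-sym a) done , sub′
    where
    sub′ : (y ∷ zs ++ x ∷ []) ⊆ (x ∷ z ∷ ys)
    sub′ p with ∈-++⁻ (y ∷ zs) p
    ... | inj₁ q        = there (sub q)
    ... | inj₂ (here e) = here e

  suffixFrom : ∀ {x ys y m} → Walk x ys y → m ∈ x ∷ ys →
    ∃ λ zs → Walk m zs y × (m ∷ zs) ⊆ (x ∷ ys) × (Unique (x ∷ ys) → Unique (m ∷ zs))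
  suffixFrom w (here refl) = _ , w , (λ p → p) , λ u → u
  suffixFrom (step a w) (there p) with suffixFrom w p
  ... | zs , w′ , sub , uniq = zs , w′ , (λ q → there (sub q)) , λ { (_ ∷ u) → uniq u }

  prefixTo : ∀ {x ys y m} → Walk x ys y → m ∈ x ∷ ys →
    ∃ λ zs → Walk x zs m × (x ∷ zs) ⊆ (x ∷ ys)
  prefixTo w (here refl) = [] , done , λ { (here e) → here e }
  prefixTo (step a w) (there p) with prefixTo w p
  ... | zs , w′ , sub = _ ∷ zs , step a w′ , λ { (here e) → here e ; (there q) → there (sub q) }

  splitAt : ∀ {x y m} (pre : List V) {post} → Walk x (pre ++ m ∷ post) y →
    Walk x pre (final x pre) × Adj (final x pre) m × Walk m post y
  splitAt []        (step a w) = done , a , w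
  splitAt (p ∷ pre) (step a w) with splitAt pre w
  ... | w₁ , a₁ , w₂ = step a w₁ , a₁ , w₂

  lastStep : ∀ {x ys y} → Walk x ys y →
    (x ≡ y × ys ≡ []) ⊎ ∃₂ λ zs p → Walk x zs p × Adj p y × ys ≡ zs ++ y ∷ []
  lastStep done = inj₁ (refl , refl)
  lastStep (step a w) with lastStep w
  ... | inj₁ (refl , refl)             = inj₂ ([] , _ , done , a , refl)
  ... | inj₂ (zs , p , w′ , a′ , refl) = inj₂ (_ ∷ zs , p , step a w′ , a′ , refl)

  open import Data.List.Membership.DecPropositional (_≟_ {n}) using (_∈?_)

  simplify : ∀ {x ys y} → Walk x ys y →
    ∃ λ zs → Walk x zs y × Unique (x ∷ zs) × (x ∷ zs) ⊆ (x ∷ ys)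
  simplify done = [] , done , [] ∷ [] , λ p → p
  simplify {x} (step {z = z} a w) with simplify w
  ... | zs , w′ , u′ , sub with x ∈? (z ∷ zs)
  ...   | no x∉ = z ∷ zs , step a w′ , ¬Any⇒All¬ _ x∉ ∷ u′ ,
                  λ { (here e) → here e ; (there q) → there (sub q) }
  ...   | yes p with suffixFrom w′ p
  ...     | zs₂ , w₂ , sub₂ , uniq = zs₂ , w₂ , uniq u′ , λ q → there (sub (sub₂ q))

  walk⇒path : ∀ {x ys y} → Walk x ys y → Unique (x ∷ ys) → Path x y (x ∷ ys)
  walk⇒path w u = chain w , refl , ends w , u
    where
    chain : ∀ {x ys y} → Walk x ys y → Chain (x ∷ ys)
    chain done       = one _
    chain (step a w) = cons _ _ _ a (chain w)
    ends : ∀ {x ys y} → Walk x ys y → Data.List.last (x ∷ ys) ≡ just y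
    ends done       = refl
    ends (step a w) = ends w

  path⇒walk : ∀ {x y xs} → Path x y xs → ∃ λ ys → xs ≡ x ∷ ys × Walk x ys y
  path⇒walk {xs = v ∷ vs} (ch , hd , lt , _) with just-injective hd
  ... | refl = vs , refl , walk ch lt
    where
    walk : ∀ {v vs y} → Chain (v ∷ vs) → Data.List.last (v ∷ vs) ≡ just y → Walk v vs y
    walk (one v) e with just-injective e
    ... | refl = done
    walk (cons u v vs a ch) e = step a (walk ch e)

  Avoiding : V → V → V → Set
  Avoiding x a c = ∃ λ ys → Walk a ys c × x ∉ a ∷ ys

  avoid-sym : ∀ {x a c} → Avoiding x a c → Avoiding x c a
  avoid-sym (ys , w , x∉) with reverseʷ w
  ... | zs , w′ , sub = zs , w′ , λ p → x∉ (sub p)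

  avoid-trans : ∀ {x a b c} → Avoiding x a b → Avoiding x b c → Avoiding x a c
  avoid-trans {x} {a} (ys , w , x∉₁) (zs , w′ , x∉₂) = ys ++ zs , w ++ʷ w′ , x∉
    where
    x∉ : x ∉ a ∷ ys ++ zs
    x∉ p with ∈-++⁻ (a ∷ ys) p
    ... | inj₁ q = x∉₁ q
    ... | inj₂ q = x∉₂ (there q)

  prefix-avoiding : ∀ {x a ys c m} → Walk a ys c → x ∉ a ∷ ys → m ∈ a ∷ ys → Avoiding x a m
  prefix-avoiding w x∉ m∈ with prefixTo w m∈
  ... | zs , w′ , sub = zs , w′ , λ p → x∉ (sub p)

  suffix-avoiding : ∀ {x a ys c m} → Walk a ys c → x ∉ a ∷ ys → m ∈ a ∷ ys → Avoiding x m c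
  suffix-avoiding w x∉ m∈ with suffixFrom w m∈
  ... | zs , w′ , sub , _ = zs , w′ , λ p → x∉ (sub p)

module Forest {n : ℕ} (Adj : Fin n → Fin n → Set)
  (simple : Graphs.Simple Adj) (acyclic : Graphs.Acyclic Adj) where

  Adj-sym : ∀ {u v} → Adj u v → Adj v u
  Adj-sym {u} {v} = proj₁ simple u v

  Adj-irrefl : ∀ {v} → ¬ Adj v v
  Adj-irrefl {v} = proj₂ simple v

  open Walks Adj Adj-sym

  -- Acyclic bounds a path closing a cycle by two vertices; a, z, …, x has three or more.
  private
    three≰two : ∀ {a z x : V} zs → ¬ (length (a ∷ z ∷ zs ++ x ∷ []) ℕ.≤ 2)
    three≰two []      (ℕ.s≤s (ℕ.s≤s ()))
    three≰two (_ ∷ _) (ℕ.s≤s (ℕ.s≤s ()))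

  -- Two distinct neighbours of x are not joined by a walk avoiding x
  -- (it would close a cycle through x).
  noDetour : ∀ {x a c ys} → Adj x a → Adj x c → a ≢ c → Walk a ys c → x ∉ a ∷ ys → ⊥
  noDetour {x} {a} xa xc a≢c w x∉ with simplify w
  ... | []     , w′ , _ , _   = a≢c (walk-[] w′)
  ... | z ∷ zs , w′ , u , sub =
    three≰two {a} {z} {x} zs (acyclic x a _ xa (walk⇒path (w′ ++ʷ step (Adj-sym xc) done) unique))
    where
    unique : Unique (a ∷ z ∷ zs ++ x ∷ [])
    unique = Unique.++⁺ u ([] ∷ []) λ { (p , here refl) → x∉ (sub p) }

  -- Two neighbours of x joined avoiding x coincide: at x, every other vertex
  -- lies in the branch of exactly one neighbour.
  sameBranch : ∀ {x a c} → Adj x a → Adj x c → Avoiding x a c → a ≡ c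
  sameBranch {a = a} {c} xa xc (_ , w , x∉) with a ≟ c
  ... | yes a≡c = a≡c
  ... | no  a≢c = ⊥-elim (noDetour xa xc a≢c w x∉)

  data NoReversal : List V → Set where
    empty  : NoReversal []
    single : ∀ {a} → NoReversal (a ∷ [])
    pair   : ∀ {a b} → NoReversal (a ∷ b ∷ [])
    turn   : ∀ {a b c r} → c ≢ a → NoReversal (b ∷ c ∷ r) → NoReversal (a ∷ b ∷ c ∷ r)

  NoReversal-tail : ∀ {a r} → NoReversal (a ∷ r) → NoReversal r
  NoReversal-tail single     = empty
  NoReversal-tail pair       = single
  NoReversal-tail (turn _ r) = r

  -- In a forest a walk without immediate reversals repeats no vertex: a first
  -- return to x would come back from a neighbour of x other than the one left to.
  noReversal⇒unique : ∀ {x ys y} → Walk x ys y → NoReversal (x ∷ ys) → Unique (x ∷ ys)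
  noReversal⇒unique done _ = [] ∷ []
  noReversal⇒unique {x} (step {z = z} {ys = ys} a w) nr = ¬Any⇒All¬ _ x∉ ∷ tail-unique
    where
    tail-unique : Unique (z ∷ ys)
    tail-unique = noReversal⇒unique w (NoReversal-tail nr)
    x∉ : x ∉ z ∷ ys
    x∉ (here refl) = Adj-irrefl a
    x∉ (there p) with ∈-∃++ p
    ... | pre , post , refl with splitAt pre w
    ...   | w₁ , a₁ , _ = noDetour a (Adj-sym a₁) (z≢final pre nr tail-unique) w₁
                            λ q → unique-++-disjoint (z ∷ pre) tail-unique q (here refl)
      where
      z≢final : ∀ pre → NoReversal (x ∷ z ∷ pre ++ x ∷ post) →
        Unique (z ∷ pre ++ x ∷ post) → z ≢ final z pre
      z≢final []         (turn x≢x _) _        _ = x≢x refl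
      z≢final (q ∷ pre′) _            (z∉ ∷ _) e = All.lookup z∉ (∈-++⁺ˡ (final∈ q pre′)) e

module Degrees {n : ℕ} (Adj : Fin n → Fin n → Set) where
  open Graphs Adj

  leaf-neighbour : ∀ {ℓ x y} → Leaf ℓ → Adj ℓ x → Adj ℓ y → x ≡ y
  leaf-neighbour (_ , _ , unique) p q = trans (unique _ p) (sym (unique _ q))

  deg3⇒¬leaf : ∀ {v} → Deg3 v → ¬ Leaf v
  deg3⇒¬leaf (_ , _ , _ , a≢b , _ , _ , va , vb , _) l = a≢b (leaf-neighbour l va vb)

module Rotation {n : ℕ} (Adj : Fin n → Fin n → Set) (rot : Fin n → Fin n → Fin n) where
  open Graphs Adj using (Deg3Rot)

  rot-adj : ∀ {v u} → Deg3Rot rot v → Adj v u → Adj v (rot v u)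
  rot-adj {v} (_ , _ , _ , _ , _ , _ , va , vb , vc , cover , ra , rb , rc) p with cover _ p
  ... | inj₁ refl         = subst (Adj v) (sym ra) vb
  ... | inj₂ (inj₁ refl) = subst (Adj v) (sym rb) vc
  ... | inj₂ (inj₂ refl) = subst (Adj v) (sym rc) va

  rot-moves : ∀ {v u} → Deg3Rot rot v → Adj v u → rot v u ≢ u
  rot-moves (_ , _ , _ , a≢b , b≢c , a≢c , _ , _ , _ , cover , ra , rb , rc) p with cover _ p
  ... | inj₁ refl         = λ e → a≢b (trans (sym e) ra)
  ... | inj₂ (inj₁ refl) = λ e → b≢c (trans (sym e) rb)
  ... | inj₂ (inj₂ refl) = λ e → a≢c (trans (sym rc) e)

  rot²-moves : ∀ {v u} → Deg3Rot rot v → Adj v u → rot v (rot v u) ≢ u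
  rot²-moves {v} (_ , _ , _ , a≢b , b≢c , a≢c , _ , _ , _ , cover , ra , rb , rc) p
    with cover _ p
  ... | inj₁ refl         = λ e → a≢c (sym (trans (sym (trans (cong (rot v) ra) rb)) e))
  ... | inj₂ (inj₁ refl) = λ e → a≢b (trans (sym (trans (cong (rot v) rb) rc)) e)
  ... | inj₂ (inj₂ refl) = λ e → b≢c (trans (sym (trans (cong (rot v) rc) ra)) e)

module ThreeTree {n : ℕ} (Adj : Fin n → Fin n → Set) (rot : Fin n → Fin n → Fin n)
  (tree : Graphs.Is3Tree Adj rot) where
  open Graphs Adj
  open Forest Adj (proj₁ (proj₁ tree)) (proj₂ (proj₂ (proj₁ tree)))
  open Walks Adj Adj-sym
  open Degrees Adj
  open Rotation Adj rot

  inner : ∀ {v} → ¬ Leaf v → Deg3Rot rot v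
  inner {v} ¬leaf with proj₂ tree v
  ... | inj₁ l = ⊥-elim (¬leaf l)
  ... | inj₂ D = D

  -- How the walk from the dart u → v ends at the leaf ℓ: either v = ℓ, or its last
  -- two vertices are c, ℓ and it arrives at c from a vertex s with rot c s = ℓ.
  LastTurn : V → V → V → List V → Set
  LastTurn ℓ u v ys = (ys ≡ []) ⊎ ∃₂ λ pre c →
    (v ∷ ys ≡ pre ++ c ∷ ℓ ∷ []) × rot c (final u pre) ≡ ℓ

  tour : ∀ {ℓ u v} → FirstLeaf rot ℓ u v → Adj u v →
    ∃ λ ys → Walk v ys ℓ × NoReversal (u ∷ v ∷ ys) × LastTurn ℓ u v ys
  tour (stop l) a = [] , done , pair , inj₁ refl
  tour {ℓ} {u} {v} (go ¬leaf fl) a with tour fl (rot-adj (inner ¬leaf) (Adj-sym a))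
  ... | ys , w , nr , lt = rot v u ∷ ys , step (rot-adj D (Adj-sym a)) w ,
                           turn (rot-moves D (Adj-sym a)) nr , extend lt
    where
    D : Deg3Rot rot v
    D = inner ¬leaf
    extend : LastTurn ℓ v (rot v u) ys → LastTurn ℓ u v (rot v u ∷ ys)
    extend (inj₁ refl) = inj₂ ([] , v , cong (λ k → v ∷ k ∷ []) (walk-[] w) , walk-[] w)
    extend (inj₂ (pre , c , eq , r)) = inj₂ (v ∷ pre , c , cong (v ∷_) eq , r)

  FirstLeaf-step : ∀ {ℓ u v} → FirstLeaf rot ℓ u v → ¬ Leaf v → FirstLeaf rot ℓ v (rot v u)
  FirstLeaf-step (stop l)  ¬leaf = ⊥-elim (¬leaf l)
  FirstLeaf-step (go _ fl) _     = fl

  -- The walk from a leaf P to the next leaf L is a path P, …, s, c, L through the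
  -- neighbour c of L, with rot c s = L.
  record Arrival (P L c : V) : Set where
    field
      before  : List V
      inbound : Walk P before (final P before)
      s-adj   : Adj (final P before) c
      turning : rot c (final P before) ≡ L
      L∉      : L ∉ P ∷ before
      c∉      : c ∉ P ∷ before

  arrival : ∀ {P L c} → Leaf P → Leaf L → NextLeaf rot P L → Adj L c → ¬ Leaf c → Arrival P L c
  arrival {P} {L} {c} lP lL (u , Pu , fl) Lc ¬leaf with tour fl Pu
  ... | _ , w , _ , inj₁ refl =
    ⊥-elim (¬leaf (subst Leaf (leaf-neighbour lL (Adj-sym (subst (Adj P) (walk-[] w) Pu)) Lc) lP))
  ... | _ , w , nr , inj₂ (pre , c′ , eq , r)
    with splitAt pre (subst (λ k → Walk P k L) eq (step Pu w))
  ...   | w₁ , sc′ , step c′L done with leaf-neighbour lL (Adj-sym c′L) Lc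
  ...     | refl = record
    { before  = pre ; inbound = w₁ ; s-adj = sc′ ; turning = r
    ; L∉      = λ q → unique-++-disjoint (P ∷ pre) unique q (there (here refl))
    ; c∉      = λ q → unique-++-disjoint (P ∷ pre) unique q (here refl)
    }
    where
    unique : Unique (P ∷ pre ++ c ∷ L ∷ [])
    unique = subst (λ k → Unique (P ∷ k)) eq (noReversal⇒unique (step Pu w) nr)

  -- The walk from a leaf L to the next leaf N is a path L, c, rot c L, …, N.
  record Departure (L N c : V) : Set where
    field
      after           : List V
      outbound        : Walk (rot c L) after N
      t-adj           : Adj c (rot c L)
      outbound-unique : Unique (c ∷ rot c L ∷ after)

  departure : ∀ {L N c} → Leaf L → NextLeaf rot L N → Adj L c → ¬ Leaf c → Departure L N c
  departure {L} {N} {c} lL (u , Lu , fl) Lc ¬leaf with leaf-neighbour lL Lu Lc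
  ... | refl =
    let ys , w , nr , _ = tour (FirstLeaf-step fl ¬leaf) c→t
    in record { after = ys ; outbound = w ; t-adj = c→t
              ; outbound-unique = noReversal⇒unique (step c→t w) nr }
    where
    c→t : Adj c (rot c L)
    c→t = rot-adj (inner ¬leaf) (Adj-sym Lc)

  returnPath : ∀ {P L c} (A : Arrival P L c) →
    ∃ λ ps → Path c P (c ∷ ps) × (∀ {m} → m ∈ c ∷ ps → m ≡ c ⊎ m ∈ P ∷ Arrival.before A)
  returnPath {P} {c = c} A with reverseʷ (Arrival.inbound A)
  ... | _ , back , back⊆ with simplify (step (Adj-sym (Arrival.s-adj A)) back)
  ...   | ps , toP , unique , toP⊆ = ps , walk⇒path toP unique , vertex
    where
    vertex : ∀ {m} → m ∈ c ∷ ps → m ≡ c ⊎ m ∈ P ∷ Arrival.before A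
    vertex p with toP⊆ p
    ... | here e  = inj₁ e
    ... | there q = inj₂ (back⊆ q)

  -- If the inner vertex b is the neighbour of L, the paths from b to P, L, N leave
  -- b through its three distinct neighbours s, L, rot b L, so they share only b.
  adjacent⇒threePaths : ∀ {P L N b} → Leaf P → Leaf L → ¬ Leaf b →
    NextLeaf rot P L → NextLeaf rot L N → Adj L b → ThreePaths b P L N
  adjacent⇒threePaths {P} {L} {N} {b} lP lL ¬leaf next₁ next₂ Lb
    with returnPath (arrival lP lL next₁ Lb ¬leaf)
  ... | ps , toP , toP-vertex =
    b ∷ ps , b ∷ L ∷ [] , b ∷ t ∷ after ,
    toP , walk⇒path (step (Adj-sym Lb) done) ((b≢L ∷ []) ∷ [] ∷ []) ,
    walk⇒path (step t-adj outbound) outbound-unique ,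
    PL , PN , LN
    where
    open Arrival (arrival lP lL next₁ Lb ¬leaf)
    open Departure (departure lL next₂ Lb ¬leaf)
    R : Deg3Rot rot b
    R = inner ¬leaf
    s t : V
    s = final P before
    t = rot b L
    b≢L : b ≢ L
    b≢L refl = Adj-irrefl Lb
    s≢t : s ≢ t
    s≢t e = rot²-moves R (Adj-sym s-adj) (sym (trans e (cong (rot b) (sym turning))))
    L≢t : L ≢ t
    L≢t e = rot-moves R (Adj-sym Lb) (sym e)
    b∉N : b ∉ t ∷ after
    b∉N = Unique.Unique[x∷xs]⇒x∉xs outbound-unique
    PL : ∀ m → m ∈ b ∷ ps → m ∈ b ∷ L ∷ [] → m ≡ b
    PL m _  (here e) = e
    PL m mp (there (here refl)) with toP-vertex mp
    ... | inj₁ e = e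
    ... | inj₂ q = ⊥-elim (L∉ q)
    PN : ∀ m → m ∈ b ∷ ps → m ∈ b ∷ t ∷ after → m ≡ b
    PN m _  (here e) = e
    PN m mp (there q′) with toP-vertex mp
    ... | inj₁ e = e
    ... | inj₂ q = ⊥-elim (s≢t (sameBranch (Adj-sym s-adj) t-adj
            (avoid-trans (avoid-sym (suffix-avoiding inbound c∉ q))
                         (avoid-sym (prefix-avoiding outbound b∉N q′)))))
    LN : ∀ m → m ∈ b ∷ L ∷ [] → m ∈ b ∷ t ∷ after → m ≡ b
    LN m (here e)           _          = e
    LN m (there (here _))   (here e)   = e
    LN m (there (here refl)) (there q′) =
      ⊥-elim (L≢t (sameBranch (Adj-sym Lb) t-adj (avoid-sym (prefix-avoiding outbound b∉N q′))))

  approachLeaf : ∀ {b qs L v} → Leaf L → Adj L v → v ≢ b → ¬ Leaf b → Walk b qs L →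
    ∃₂ λ qs′ s′ → Walk b qs′ s′ × Adj s′ v × qs ≡ qs′ ++ v ∷ L ∷ []
  approachLeaf {L = L} lL Lv v≢b ¬leaf w with lastStep w
  ... | inj₁ (refl , _) = ⊥-elim (¬leaf lL)
  ... | inj₂ (zs , z , w′ , zL , refl) with leaf-neighbour lL (Adj-sym zL) Lv
  ...   | refl with lastStep w′
  ...     | inj₁ (b≡z , _) = ⊥-elim (v≢b (sym b≡z))
  ...     | inj₂ (qs′ , s′ , w″ , s′z , refl) = qs′ , s′ , w″ , s′z , ++-assoc qs′ (z ∷ []) (L ∷ [])

  -- If L's neighbour v is not b, paths from b to P, L, N sharing only b would join
  -- both neighbours s and rot v L of v to the vertex s′ preceding v on the path to
  -- L while avoiding v; so s = s′ = rot v L, impossible as rot v is a 3-cycle.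
  notThreePaths : ∀ {P L N b v} → Leaf P → Leaf L → ¬ Leaf b →
    NextLeaf rot P L → NextLeaf rot L N → Adj L v → v ≢ b → ¬ ThreePaths b P L N
  notThreePaths {P} {L} {N} {b} {v} lP lL ¬leaf next₁ next₂ Lv v≢b
    (_ , _ , _ , pathP , pathL , pathN , PL , _ , LN)
    with path⇒walk pathP | path⇒walk pathL | path⇒walk pathN
  ... | ps , refl , toP | _ , refl , toL | rs , refl , toN with approachLeaf lL Lv v≢b ¬leaf toL
  ...   | qs′ , s′ , toS′ , s′v , refl =
    rot²-moves R (Adj-sym s-adj) (trans (cong (rot v) turning) (trans t≡s′ (sym s≡s′)))
    where
    uniqueL : Unique (b ∷ qs′ ++ v ∷ L ∷ [])
    uniqueL = proj₂ (proj₂ (proj₂ pathL))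
    v∉toS′ : v ∉ b ∷ qs′
    v∉toS′ m = unique-++-disjoint (b ∷ qs′) uniqueL m (here refl)
    L∉toS′ : L ∉ b ∷ qs′
    L∉toS′ m = unique-++-disjoint (b ∷ qs′) uniqueL m (there (here refl))
    v∈toL : v ∈ b ∷ qs′ ++ v ∷ L ∷ []
    v∈toL = there (∈-++⁺ʳ qs′ (here refl))
    ¬leaf-v : ¬ Leaf v
    ¬leaf-v lv = L∉toS′ (subst (_∈ b ∷ qs′) (leaf-neighbour lv (Adj-sym s′v) (Adj-sym Lv)) (end∈ toS′))
    R : Deg3Rot rot v
    R = inner ¬leaf-v
    open Arrival (arrival lP lL next₁ Lv ¬leaf-v)
    open Departure (departure lL next₂ Lv ¬leaf-v)
    b→s′ : Avoiding v b s′
    b→s′ = _ , toS′ , v∉toS′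
    P→b : Avoiding v P b
    P→b = avoid-sym (_ , toP , λ m → v≢b (PL v m v∈toL))
    N→b : Avoiding v N b
    N→b = avoid-sym (_ , toN , λ m → v≢b (LN v v∈toL m))
    s≡s′ : final P before ≡ s′
    s≡s′ = sameBranch (Adj-sym s-adj) (Adj-sym s′v)
             (avoid-trans (avoid-sym (_ , inbound , c∉)) (avoid-trans P→b b→s′))
    t≡s′ : rot v L ≡ s′
    t≡s′ = sameBranch t-adj (Adj-sym s′v)
             (avoid-trans (_ , outbound , Unique.Unique[x∷xs]⇒x∉xs outbound-unique)
                          (avoid-trans N→b b→s′))

  threePaths⇒adjacent : ∀ {P L N b} → Leaf P → Leaf L → ¬ Leaf b →
    NextLeaf rot P L → NextLeaf rot L N → ThreePaths b P L N → Adj L b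
  threePaths⇒adjacent {b = b} lP lL@(v , Lv , _) ¬leaf next₁ next₂ tp with v ≟ b
  ... | yes refl = Lv
  ... | no  v≢b  = ⊥-elim (notThreePaths lP lL ¬leaf next₁ next₂ Lv v≢b tp)

  consecutiveLeaves : ∀ {P L N b} → Leaf P → Leaf L → ¬ Leaf b →
    NextLeaf rot P L → NextLeaf rot L N → ThreePaths b P L N ⇔ Adj L b
  consecutiveLeaves lP lL ¬leaf next₁ next₂ =
    mk⇔ (threePaths⇒adjacent lP lL ¬leaf next₁ next₂) (adjacent⇒threePaths lP lL ¬leaf next₁ next₂)

  -- Reversing the roles of the outer endpoints, needed for the other orientation.
  ThreePaths-swap : ∀ {b x y z} → ThreePaths b x y z ⇔ ThreePaths b z y x
  ThreePaths-swap = mk⇔ swap swap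
    where
    swap : ∀ {b x y z} → ThreePaths b x y z → ThreePaths b z y x
    swap (p , q , r , Pp , Pq , Pr , pq , pr , qr) =
      r , q , p , Pr , Pq , Pp , (λ v x y → qr v y x) , (λ v x y → pr v y x) , (λ v x y → pq v y x)

lemma3p14 : ∀ {c ℓ₁ ℓ₂ : Level} (R : OrderedCommRing c ℓ₁ ℓ₂) {d : ℕ}
    (X : Geometry.TDiagram R d) (T : Geometry.CharTree R X)
    (w : Fin (suc d)) (i : Fin (3 + d)) →
    Geometry.Corresponds R X w i ⇔
      Geometry.CharTree.Adj T (Geometry.CharTree.φ T (inj₁ i)) (Geometry.CharTree.φ T (inj₂ w))
lemma3p14 R {d} X T w i = ⇔.trans triangle (treeSide leafOrder)
  where
  open Geometry.CharTree T
  open ThreeTree Adj rot is3Tree using (consecutiveLeaves; ThreePaths-swap)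
  open Degrees Adj using (deg3⇒¬leaf)
  B : Fin size
  B = φ (inj₂ w)
  A : Fin (3 + d) → Fin size
  A j = φ (inj₁ j)
  triangle : Geometry.Corresponds R X w i ⇔ ThreePaths B (A (cpred i)) (A i) (A (csuc i))
  triangle = triangles w (cpred i) i (csuc i) (cpred≢ i) (≢csuc i) (cpred≢csuc i)
  treeSide : (∀ j → NextLeaf rot (A j) (A (csuc j))) ⊎ (∀ j → NextLeaf rot (A j) (A (cpred j))) →
    ThreePaths B (A (cpred i)) (A i) (A (csuc i)) ⇔ Adj (A i) B
  treeSide (inj₁ next) = consecutiveLeaves (blackLeaf _) (blackLeaf i) (deg3⇒¬leaf (whiteDeg3 w))
    (subst (λ j → NextLeaf rot (A (cpred i)) (A j)) (csuc-cpred i) (next (cpred i))) (next i)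
  treeSide (inj₂ prev) = ⇔.trans ThreePaths-swap (consecutiveLeaves (blackLeaf _) (blackLeaf i)
    (deg3⇒¬leaf (whiteDeg3 w)) (subst (λ j → NextLeaf rot (A (csuc i)) (A j)) (cpred-csuc i) (prev (csuc i)))
    (prev i))
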